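{- Let $r,s\ge1$ and $p_1,\dots,p_r,q_1,\dots,q_s$ be positive integers with $\{p_i\}\cap\{q_j\}=\emptyset$, $q_s=1$ and $\sum_ip_i=\sum_jq_j=L$; put $n=r+s-1$, and let ${\bf e}_i$, $G$, $H$, primitivity and ${\bf u}_\mu$ be as in the context. Let $\beta=\bigcup_{j=1}^s\{\tfrac{i}{q_j}:1\le i\le q_j\}$. Then for every primitive ${\bf v}\in G$ there exists $b\in\beta$ such that $${\bf v}\in{\bf u}_b+\{{\bf u}+j{\bf e}_n:\ {\bf u}\in H,\ j\in\mathbb Z_{\ge0}\}.$$
   Context: ${\bf e}_0=[1,0,\dots,0]$; for $1\le i\le n-1$, ${\bf e}_i\in\mathbb Z^n$ has first coordinate $1$, $(i+1)$-st coordinate $1$ and other coordinates $0$; ${\bf e}_n=[1,p_1,\dots,p_{r-1},-q_1,\dots,-q_{s-1}]$. $G=\{\sum_{i=0}^nc_i{\bf e}_i:c_i\in\mathbb R_{\ge0}\}\cap\mathbb Z^n$, $H=\{\sum_{i=0}^{n-1}a_i{\bf e}_i:a_i\in\mathbb Z_{\ge0}\}$. The depth of a vector is the sum of its negative entries; an element of $G$ is primitive if its depth is negative. With $\{x\}=x-\lfloor x\rfloor$, for rational $\mu\in[0,1]$, ${\bf u}_\mu=\mu{\bf e}_n+\{ -\mu p_r\}{\bf e}_0+\sum_{i=1}^{r-1}\{ -\mu p_i\}{\bf e}_i+\sum_{j=1}^{s-1}\{\mu q_j\}{\bf e}_{r-1+j}$.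
   Formalization: The coefficients $c_i$ spanning the cone $G$ range over the nonnegative rationals rather than the nonnegative reals. -}

module Defs where

open import Data.Nat as ℕ using (ℕ; zero; suc; _∸_; _≡ᵇ_; _<ᵇ_)
open import Data.Bool using (if_then_else_)
open import Data.Fin using (Fin; toℕ)
open import Data.Product using (Σ; _×_)
open import Relation.Binary.PropositionalEquality using (_≡_; _≢_)
open import Data.Integer as ℤ using (ℤ; +_)
open import Data.Rational as ℚ using (ℚ; 0ℚ; 1ℚ; _+_; _*_; _-_; -_; floor)

ℕtoℚ : ℕ → ℚ
ℕtoℚ k = (+ k) ℚ./ 1

ℤtoℚ : ℤ → ℚ
ℤtoℚ z = z ℚ./ 1

frac : ℚ → ℚ
frac x = x - ℤtoℚ (floor x)

-- i / d as a rational (only used with d ≥ 1; value 0 for d = 0)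
divℚ : ℕ → ℕ → ℚ
divℚ i zero    = 0ℚ
divℚ i (suc d) = (+ i) ℚ./ suc d

-- Σ_{i=a}^{b} f i  (i ranging over a, a+1, …, b; empty if b < a)
sumFrom : ℕ → ℕ → (ℕ → ℚ) → ℚ
sumFrom a b f = go (suc b ∸ a)
  where
  go : ℕ → ℚ
  go zero    = 0ℚ
  go (suc k) = go k + f (a ℕ.+ k)

sumℤ : (n : ℕ) → (Fin n → ℤ) → ℤ
sumℤ zero    v = + 0
sumℤ (suc n) v = v Fin.zero ℤ.+ sumℤ n (λ k → v (Fin.suc k))
  where import Data.Fin as Fin

-- Standing data: r s ≥ 1, p_1..p_r, q_1..q_s given as functions ℕ → ℕ
-- (1-based; values outside the ranges are irrelevant), n = r + s - 1.
-- Vectors of ℤ^n (resp. ℚ^n) are functions Fin n → ℤ (resp. ℚ); the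
-- coordinate with 0-based position c is the (c+1)-st coordinate.
module Setup (r s : ℕ) (p q : ℕ → ℕ) where

  n : ℕ
  n = r ℕ.+ s ∸ 1

  e : ℕ → Fin n → ℚ
  e i k with toℕ k
  ... | zero  = 1ℚ
  ... | suc c = if (suc c ≡ᵇ i) then 1ℚ else 0ℚ

  -- e_n = [1, p_1, …, p_{r-1}, -q_1, …, -q_{s-1}]
  eₙ : Fin n → ℚ
  eₙ k with toℕ k
  ... | zero  = 1ℚ
  ... | suc c = if (suc c <ᵇ r) then ℕtoℚ (p (suc c))
                else - ℕtoℚ (q (suc c ∸ r ℕ.+ 1))

  gen : ℕ → Fin n → ℚ
  gen i = if (i ≡ᵇ n) then eₙ else e i

  InG : (Fin n → ℤ) → Set
  InG v = Σ (ℕ → ℚ) λ c → (∀ i → i ℕ.≤ n → 0ℚ ℚ.≤ c i)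
        × (∀ k → sumFrom 0 n (λ i → c i * gen i k) ≡ ℤtoℚ (v k))

  depth : (Fin n → ℤ) → ℤ
  depth v = sumℤ n (λ k → v k ℤ.⊓ + 0)

  Primitive : (Fin n → ℤ) → Set
  Primitive v = InG v × depth v ℤ.< + 0

  u : ℚ → Fin n → ℚ
  u μ k = μ * eₙ k
        + frac (- (μ * ℕtoℚ (p r))) * e 0 k
        + sumFrom 1 (r ∸ 1) (λ i → frac (- (μ * ℕtoℚ (p i))) * e i k)
        + sumFrom 1 (s ∸ 1) (λ j → frac (μ * ℕtoℚ (q j)) * e (r ∸ 1 ℕ.+ j) k)

  Inβ : ℚ → Set
  Inβ b = Σ ℕ λ j → (1 ℕ.≤ j) × (j ℕ.≤ s) ×
          Σ ℕ λ i → (1 ℕ.≤ i) × (i ℕ.≤ q j) × (b ≡ divℚ i (q j))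
  
  -- v ∈ u_b + { h + j e_n : h ∈ H, j ∈ ℤ≥0 },  H = { Σ_{i=0}^{n-1} a_i e_i : a_i ∈ ℤ≥0 }
  InTranslate : ℚ → (Fin n → ℤ) → Set
  InTranslate b v = Σ (ℕ → ℕ) λ a → Σ ℕ λ j → ∀ k →
    ℤtoℚ (v k) ≡ u b k + sumFrom 0 (n ∸ 1) (λ i → ℕtoℚ (a i) * e i k) + ℕtoℚ j * eₙ k

sumℕ : ℕ → (ℕ → ℕ) → ℕ
sumℕ zero    f = 0
sumℕ (suc m) f = sumℕ m f ℕ.+ f (suc m)

{-# OPTIONS --safe #-}
-- Since Σ p = Σ q and q s = 1, eₙ = p r e₀ + Σ_{i ≥ 1} (eₙ)ᵢ eᵢ, so e₀, …, eₙ₋₁ is a ℤ-basis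
-- of ℤⁿ in which eₙ has coordinates d (d₀ = p r, and dᵢ = pᵢ or −q_j for i ≥ 1), and a point
-- v = Σ cᵢ eᵢ + cₙ eₙ of G has integral coordinates wᵢ = cᵢ + cₙ dᵢ. The first r coordinates of
-- v are nonnegative, so a primitive v has some w_{r-1+j} < 0; then μ = max_j (−w_{r-1+j} / q_j)
-- is positive, at most cₙ, and makes every wᵢ − μ dᵢ nonnegative. Writing μ = b + J with
-- b = i / q_J ∈ β and J ∈ ℕ, each wᵢ − μ dᵢ is {−b dᵢ} plus a nonnegative integer aᵢ, and
-- comparing coordinates in the basis gives v = u_b + Σ aᵢ eᵢ + J eₙ.

module Submission where

open import Defs
open import Data.Nat as ℕ using (ℕ; zero; suc; _∸_; _≡ᵇ_; _<ᵇ_; z≤n; s≤s)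
import Data.Nat.Properties as ℕ
import Data.Nat.DivMod as ℕ
open import Data.Nat.Coprimality using (1-coprimeTo) renaming (sym to coprime-sym)
open import Data.Integer as ℤ using (ℤ; +_; -[1+_]; +[1+_]; 0ℤ; 1ℤ; -1ℤ)
import Data.Integer.Properties as ℤ
import Data.Integer.DivMod as ℤ
open import Data.Integer.Solver using (module +-*-Solver)
open import Data.Rational as ℚ using (ℚ; mkℚ; *≤*; *<*; 0ℚ; 1ℚ; _+_; _*_; _-_; -_; floor; _≤_; _<_)
open import Data.Rational.Properties
open import Data.Rational.Solver renaming (module +-*-Solver to ℚ-Solver)
import Data.Rational.Unnormalised as ℚᵘ
import Data.Rational.Unnormalised.Properties as ℚᵘ
open import Data.Fin as Fin using (Fin; toℕ; fromℕ<)
import Data.Fin.Properties as Fin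
open import Data.Bool using (true; false; if_then_else_)
open import Data.Product using (Σ; ∃; _×_; _,_)
open import Data.Sum using (inj₁; inj₂)
open import Data.Empty using (⊥-elim)
open import Function using (_∘_)
open import Algebra.Bundles using (CommutativeMonoid)
open import Algebra.Properties.Group +-0-group using (⁻¹-involutive)
open import Algebra.Properties.CommutativeSemigroup (CommutativeMonoid.commutativeSemigroup +-0-commutativeMonoid)
  using (interchange)
open import Relation.Nullary using (yes; no)
open import Relation.Binary.PropositionalEquality hiding (J)

-- ℤ inside ℚ: embedding, floor and fractional part

ℤtoℚ≡mkℚ : ∀ z → ℤtoℚ z ≡ mkℚ z 0 (coprime-sym (1-coprimeTo _))
ℤtoℚ≡mkℚ z = ↥p/↧p≡p (mkℚ z 0 _)

ℤtoℚ-homo-+ : ∀ a b → ℤtoℚ (a ℤ.+ b) ≡ ℤtoℚ a + ℤtoℚ b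
ℤtoℚ-homo-+ a b rewrite ℤtoℚ≡mkℚ a | ℤtoℚ≡mkℚ b =
  cong (ℚ._/ 1) (cong₂ ℤ._+_ (sym (ℤ.*-identityʳ a)) (sym (ℤ.*-identityʳ b)))

ℤtoℚ-homo-* : ∀ a b → ℤtoℚ (a ℤ.* b) ≡ ℤtoℚ a * ℤtoℚ b
ℤtoℚ-homo-* a b rewrite ℤtoℚ≡mkℚ a | ℤtoℚ≡mkℚ b = refl

ℤtoℚ-homo‿- : ∀ a → ℤtoℚ (ℤ.- a) ≡ - ℤtoℚ a
ℤtoℚ-homo‿- (+ zero)   = refl
ℤtoℚ-homo‿- +[1+ m ]   = refl
ℤtoℚ-homo‿- -[1+ m ]   = sym (⁻¹-involutive (ℤtoℚ +[1+ m ]))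

ℕtoℚ-homo-+ : ∀ a b → ℕtoℚ (a ℕ.+ b) ≡ ℕtoℚ a + ℕtoℚ b
ℕtoℚ-homo-+ a b = ℤtoℚ-homo-+ (+ a) (+ b)

ℕtoℚ-homo-* : ∀ a b → ℕtoℚ (a ℕ.* b) ≡ ℕtoℚ a * ℕtoℚ b
ℕtoℚ-homo-* a b = trans (cong ℤtoℚ (ℤ.pos-* a b)) (ℤtoℚ-homo-* (+ a) (+ b))

ℤtoℚ-mono-≤ : ∀ {a b} → a ℤ.≤ b → ℤtoℚ a ≤ ℤtoℚ b
ℤtoℚ-mono-≤ {a} {b} a≤b rewrite ℤtoℚ≡mkℚ a | ℤtoℚ≡mkℚ b =
  *≤* (subst₂ ℤ._≤_ (sym (ℤ.*-identityʳ a)) (sym (ℤ.*-identityʳ b)) a≤b)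

ℤtoℚ-mono-< : ∀ {a b} → a ℤ.< b → ℤtoℚ a < ℤtoℚ b
ℤtoℚ-mono-< {a} {b} a<b rewrite ℤtoℚ≡mkℚ a | ℤtoℚ≡mkℚ b =
  *<* (subst₂ ℤ._<_ (sym (ℤ.*-identityʳ a)) (sym (ℤ.*-identityʳ b)) a<b)

ℤtoℚ-cancel-≤ : ∀ {a b} → ℤtoℚ a ≤ ℤtoℚ b → a ℤ.≤ b
ℤtoℚ-cancel-≤ {a} {b} a≤b rewrite ℤtoℚ≡mkℚ a | ℤtoℚ≡mkℚ b with a≤b
... | *≤* a*1≤b*1 = subst₂ ℤ._≤_ (ℤ.*-identityʳ a) (ℤ.*-identityʳ b) a*1≤b*1

ℤtoℚ-cancel-< : ∀ {a b} → ℤtoℚ a < ℤtoℚ b → a ℤ.< b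
ℤtoℚ-cancel-< {a} {b} a<b rewrite ℤtoℚ≡mkℚ a | ℤtoℚ≡mkℚ b with a<b
... | *<* a*1<b*1 = subst₂ ℤ._<_ (ℤ.*-identityʳ a) (ℤ.*-identityʳ b) a*1<b*1

ℕtoℚ-nonNeg : ∀ m → 0ℚ ≤ ℕtoℚ m
ℕtoℚ-nonNeg m = ℤtoℚ-mono-≤ {0ℤ} {+ m} (ℤ.+≤+ z≤n)

ℕtoℚ-pos : ∀ {m} → 1 ℕ.≤ m → ℚ.Positive (ℕtoℚ m)
ℕtoℚ-pos {suc m} _ rewrite ℤtoℚ≡mkℚ (+ suc m) = _

p≤q⇒0≤q-p : ∀ {p q} → p ≤ q → 0ℚ ≤ q - p
p≤q⇒0≤q-p {p} {q} p≤q = subst (_≤ q - p) (+-inverseʳ p) (+-monoˡ-≤ (- p) p≤q)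

*-nonNeg : ∀ {x y} → 0ℚ ≤ x → 0ℚ ≤ y → 0ℚ ≤ x * y
*-nonNeg {x} {y} x≥0 y≥0 = subst (_≤ x * y) (*-zeroˡ y) (*-monoʳ-≤-nonNeg y {{ℚ.nonNegative y≥0}} x≥0)

*-cancelʳ-≡-pos : ∀ r .{{_ : ℚ.Positive r}} {p q} → p * r ≡ q * r → p ≡ q
*-cancelʳ-≡-pos r pr≡qr =
  ≤-antisym (*-cancelʳ-≤-pos r (≤-reflexive pr≡qr)) (*-cancelʳ-≤-pos r (≤-reflexive (sym pr≡qr)))

x<⌊x⌋+1 : ∀ x → x < ℤtoℚ (floor x ℤ.+ 1ℤ)
x<⌊x⌋+1 x@(mkℚ n d-1 _) rewrite ℤtoℚ≡mkℚ (floor x ℤ.+ 1ℤ) = *<* (begin-strict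
  n ℤ.* 1ℤ                   ≡⟨ ℤ.*-identityʳ n ⟩
  n                          ≡⟨ ℤ.a≡a%n+[a/n]*n n d ⟩
  + (n ℤ.% d) ℤ.+ ⌊x⌋ ℤ.* d  <⟨ ℤ.+-monoˡ-< (⌊x⌋ ℤ.* d) (ℤ.+<+ (ℤ.n%d<d n d)) ⟩
  d ℤ.+ ⌊x⌋ ℤ.* d            ≡⟨ solve 2 (λ d f → d :+ f :* d := (f :+ con 1ℤ) :* d) refl d ⌊x⌋ ⟩
  (⌊x⌋ ℤ.+ 1ℤ) ℤ.* d         ∎)
  where
  open ℤ.≤-Reasoning
  open +-*-Solver
  d ⌊x⌋ : ℤ
  d = + suc d-1
  ⌊x⌋ = n ℤ./ d

frac<1 : ∀ x → frac x < 1ℚ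
frac<1 x = subst (frac x <_) ⌊x⌋+1-⌊x⌋≡1 (+-monoˡ-< (- ℤtoℚ (floor x)) (x<⌊x⌋+1 x))
  where
  ⌊x⌋+1-⌊x⌋≡1 : ℤtoℚ (floor x ℤ.+ 1ℤ) - ℤtoℚ (floor x) ≡ 1ℚ
  ⌊x⌋+1-⌊x⌋≡1 rewrite ℤtoℚ-homo-+ (floor x) 1ℤ =
    ℚ-Solver.solve 1 (λ f → (f :+ con 1ℚ) :- f := con 1ℚ) refl (ℤtoℚ (floor x))
    where open ℚ-Solver

nonNeg-integer : ∀ {z f} → 0ℚ ≤ ℤtoℚ z + f → f < 1ℚ → 0ℤ ℤ.≤ z
nonNeg-integer {+ _}      _       _   = ℤ.+≤+ z≤n
nonNeg-integer { -[1+ m ]} 0≤z+f f<1 = ⊥-elim (<-irrefl refl (≤-<-trans 0≤z+f z+f<0))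
  where
  z+f<0 : ℤtoℚ -[1+ m ] + _ < 0ℚ
  z+f<0 = +-mono-≤-< (ℤtoℚ-mono-≤ { -[1+ m ]} { -1ℤ} (ℤ.-≤- z≤n)) f<1

floor-decomposition : ∀ w d b J →
  ℤtoℚ (w ℤ.- + J ℤ.* d ℤ.+ floor (- (b * ℤtoℚ d))) + frac (- (b * ℤtoℚ d)) ≡ ℤtoℚ w - (b + ℕtoℚ J) * ℤtoℚ d
floor-decomposition w d b J = begin
  ℤtoℚ (w ℤ.- + J ℤ.* d ℤ.+ ⌊φ⌋) + (φ - ℤtoℚ ⌊φ⌋)
    ≡⟨ cong (_+ (φ - ℤtoℚ ⌊φ⌋)) (trans (ℤtoℚ-homo-+ (w ℤ.- + J ℤ.* d) ⌊φ⌋) (cong (_+ ℤtoℚ ⌊φ⌋)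
         (trans (ℤtoℚ-homo-+ w (ℤ.- (+ J ℤ.* d))) (cong (λ x → ℤtoℚ w + x)
           (trans (ℤtoℚ-homo‿- (+ J ℤ.* d)) (cong -_ (ℤtoℚ-homo-* (+ J) d))))))) ⟩
  ℤtoℚ w + - (ℕtoℚ J * ℤtoℚ d) + ℤtoℚ ⌊φ⌋ + (- (b * ℤtoℚ d) - ℤtoℚ ⌊φ⌋)
    ≡⟨ solve 5 (λ w j d f b → w :+ :- (j :* d) :+ f :+ (:- (b :* d) :- f) := w :- (b :+ j) :* d)
               refl (ℤtoℚ w) (ℕtoℚ J) (ℤtoℚ d) (ℤtoℚ ⌊φ⌋) b ⟩
  ℤtoℚ w - (b + ℕtoℚ J) * ℤtoℚ d ∎
  where
  open ≡-Reasoning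
  open ℚ-Solver
  φ : ℚ
  φ = - (b * ℤtoℚ d)
  ⌊φ⌋ : ℤ
  ⌊φ⌋ = floor φ

-- Choosing the shift μ

infixl 7 _/ℕ_
_/ℕ_ : ℤ → ℕ → ℚ
z /ℕ zero  = 0ℚ
z /ℕ suc d = z ℚ./ suc d

z/q*q≡z : ∀ z {q} → 1 ℕ.≤ q → z /ℕ q * ℕtoℚ q ≡ ℤtoℚ z
z/q*q≡z z {suc d} _ = toℚᵘ-injective (begin
  ℚ.toℚᵘ (z ℚ./ suc d * ℕtoℚ (suc d))             ≈⟨ toℚᵘ-homo-* (z ℚ./ suc d) (ℕtoℚ (suc d)) ⟩
  ℚ.toℚᵘ (z ℚ./ suc d) ℚᵘ.* ℚ.toℚᵘ (ℕtoℚ (suc d)) ≈⟨ ℚᵘ.*-cong (toℚᵘ-fromℚᵘ (ℚᵘ.mkℚᵘ z d)) (toℚᵘ-cong (ℤtoℚ≡mkℚ (+ suc d))) ⟩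
  ℚᵘ.mkℚᵘ z d ℚᵘ.* ℚᵘ.mkℚᵘ (+ suc d) 0            ≈⟨ ℚᵘ.*≡* (solve 2 (λ z d → (z :* d) :* con 1ℤ := z :* (d :* con 1ℤ)) refl z (+ suc d)) ⟩
  ℚᵘ.mkℚᵘ z 0                                      ≈⟨ toℚᵘ-cong (ℤtoℚ≡mkℚ z) ⟨
  ℚ.toℚᵘ (ℤtoℚ z)                                  ∎)
  where
  open ℚᵘ.≃-Reasoning
  open +-*-Solver

fraction-split : ∀ {q} → 1 ℕ.≤ q → ∀ μ {z} → z ℤ.< 0ℤ → μ * ℕtoℚ q ≡ ℤtoℚ (ℤ.- z) →
                 Σ ℕ λ i → Σ ℕ λ J → 1 ℕ.≤ i × i ℕ.≤ q × μ ≡ divℚ i q + ℕtoℚ J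
fraction-split {suc d} q≥1 μ { -[1+ m ]} _ μq≡1+m =
  suc (m ℕ.% q) , m ℕ./ q , s≤s z≤n , ℕ.m%n<n m q ,
  *-cancelʳ-≡-pos (ℕtoℚ q) {{ℕtoℚ-pos q≥1}} (begin
    μ * ℕtoℚ q                                          ≡⟨ μq≡1+m ⟩
    ℕtoℚ (suc m)                                        ≡⟨ cong (ℕtoℚ ∘ suc) (ℕ.m≡m%n+[m/n]*n m q) ⟩
    ℕtoℚ (i ℕ.+ m ℕ./ q ℕ.* q)                          ≡⟨ ℕtoℚ-homo-+ i _ ⟩
    ℕtoℚ i + ℕtoℚ (m ℕ./ q ℕ.* q)                       ≡⟨ cong₂ _+_ (sym (z/q*q≡z (+ i) (s≤s z≤n))) (ℕtoℚ-homo-* (m ℕ./ q) q) ⟩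
    divℚ i q * ℕtoℚ q + ℕtoℚ (m ℕ./ q) * ℕtoℚ q         ≡⟨ *-distribʳ-+ (ℕtoℚ q) (divℚ i q) _ ⟨
    (divℚ i q + ℕtoℚ (m ℕ./ q)) * ℕtoℚ q                ∎)
  where
  open ≡-Reasoning
  q i : ℕ
  q = suc d
  i = suc (m ℕ.% q)
fraction-split {suc d} _ μ {+ _} (ℤ.+<+ ()) _

∃-argmax : ∀ (g : ℕ → ℚ) m → 1 ℕ.≤ m →
           Σ ℕ λ J → 1 ℕ.≤ J × J ℕ.≤ m × (∀ j → 1 ℕ.≤ j → j ℕ.≤ m → g j ≤ g J)
∃-argmax g (suc zero) _ = 1 , s≤s z≤n , s≤s z≤n , λ { (suc zero) _ _ → ≤-refl ; (suc (suc _)) _ (s≤s ()) }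
∃-argmax g (suc (suc m)) _ with ∃-argmax g (suc m) (s≤s z≤n)
... | J , 1≤J , J≤m , max with ≤-total (g J) (g (suc (suc m)))
...   | inj₁ gJ≤gm = suc (suc m) , s≤s z≤n , ℕ.≤-refl , case
  where
  case : ∀ j → 1 ℕ.≤ j → j ℕ.≤ suc (suc m) → g j ≤ g (suc (suc m))
  case j 1≤j j≤m with ℕ.m≤n⇒m<n∨m≡n j≤m
  ... | inj₁ j<m  = ≤-trans (max j 1≤j (ℕ.≤-pred j<m)) gJ≤gm
  ... | inj₂ refl = ≤-refl
...   | inj₂ gm≤gJ = J , 1≤J , ℕ.m≤n⇒m≤1+n J≤m , case
  where
  case : ∀ j → 1 ℕ.≤ j → j ℕ.≤ suc (suc m) → g j ≤ g J
  case j 1≤j j≤m with ℕ.m≤n⇒m<n∨m≡n j≤m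
  ... | inj₁ j<m  = max j 1≤j (ℕ.≤-pred j<m)
  ... | inj₂ refl = gm≤gJ

record MinimalShift (z : ℕ → ℤ) (q : ℕ → ℕ) (m : ℕ) : Set where
  field
    μ        : ℚ
    J        : ℕ
    1≤J      : 1 ℕ.≤ J
    J≤m      : J ℕ.≤ m
    zJ<0     : z J ℤ.< 0ℤ
    tight    : μ * ℕtoℚ (q J) ≡ ℤtoℚ (ℤ.- z J)
    feasible : ∀ j → 1 ℕ.≤ j → j ℕ.≤ m → 0ℚ ≤ ℤtoℚ (z j) + μ * ℕtoℚ (q j)

minimal-shift : ∀ z q m → (∀ j → 1 ℕ.≤ j → j ℕ.≤ m → 1 ℕ.≤ q j) →
                ∀ j₀ → 1 ℕ.≤ j₀ → j₀ ℕ.≤ m → z j₀ ℤ.< 0ℤ → MinimalShift z q m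
minimal-shift z q m q≥1 j₀ 1≤j₀ j₀≤m zj₀<0 = shift (∃-argmax g m (ℕ.≤-trans 1≤j₀ j₀≤m))
  where
  g : ℕ → ℚ
  g j = ℤ.- z j /ℕ q j
  gq≡-z : ∀ j → 1 ℕ.≤ j → j ℕ.≤ m → g j * ℕtoℚ (q j) ≡ ℤtoℚ (ℤ.- z j)
  gq≡-z j 1≤j j≤m = z/q*q≡z (ℤ.- z j) (q≥1 j 1≤j j≤m)
  shift : (Σ ℕ λ J → 1 ℕ.≤ J × J ℕ.≤ m × (∀ j → 1 ℕ.≤ j → j ℕ.≤ m → g j ≤ g J)) → MinimalShift z q m
  shift (J , 1≤J , J≤m , g≤gJ) = record
    { μ = g J ; J = J ; 1≤J = 1≤J ; J≤m = J≤m
    ; zJ<0 = ℤ.neg-cancel-< (ℤtoℚ-cancel-< (subst₂ _<_ (*-zeroˡ (ℕtoℚ (q J))) (gq≡-z J 1≤J J≤m)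
               (*-monoˡ-<-pos (ℕtoℚ (q J)) {{ℕtoℚ-pos (q≥1 J 1≤J J≤m)}} gJ>0)))
    ; tight = gq≡-z J 1≤J J≤m
    ; feasible = feasible
    }
    where
    gJq≥-z : ∀ j → 1 ℕ.≤ j → j ℕ.≤ m → ℤtoℚ (ℤ.- z j) ≤ g J * ℕtoℚ (q j)
    gJq≥-z j 1≤j j≤m = subst (_≤ g J * ℕtoℚ (q j)) (gq≡-z j 1≤j j≤m)
      (*-monoʳ-≤-nonNeg (ℕtoℚ (q j)) {{ℚ.nonNegative (ℕtoℚ-nonNeg (q j))}} (g≤gJ j 1≤j j≤m))
    feasible : ∀ j → 1 ℕ.≤ j → j ℕ.≤ m → 0ℚ ≤ ℤtoℚ (z j) + g J * ℕtoℚ (q j)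
    feasible j 1≤j j≤m = subst (_≤ ℤtoℚ (z j) + g J * ℕtoℚ (q j))
      (trans (cong (λ x → ℤtoℚ (z j) + x) (ℤtoℚ-homo‿- (z j))) (+-inverseʳ (ℤtoℚ (z j))))
      (+-monoʳ-≤ (ℤtoℚ (z j)) (gJq≥-z j 1≤j j≤m))
    gJ>0 : 0ℚ < g J
    gJ>0 = *-cancelʳ-<-nonNeg (ℕtoℚ (q j₀)) {{ℚ.nonNegative (ℕtoℚ-nonNeg (q j₀))}}
      (subst (_< g J * ℕtoℚ (q j₀)) (sym (*-zeroˡ (ℕtoℚ (q j₀))))
        (<-≤-trans (ℤtoℚ-mono-< (ℤ.neg-mono-< zj₀<0)) (gJq≥-z j₀ 1≤j₀ j₀≤m)))

∃-negative-entry : ∀ m (f : Fin m → ℤ) → sumℤ m (λ k → f k ℤ.⊓ 0ℤ) ℤ.< 0ℤ → ∃ λ k → f k ℤ.< 0ℤ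
∃-negative-entry zero    f (ℤ.+<+ ())
∃-negative-entry (suc m) f sum<0 with f Fin.zero ℤ.<? 0ℤ
... | yes f0<0 = Fin.zero , f0<0
... | no  f0≮0 with ∃-negative-entry m (f ∘ Fin.suc) tail<0
  where
  tail : ℤ
  tail = sumℤ m (λ k → f (Fin.suc k) ℤ.⊓ 0ℤ)
  tail<0 : tail ℤ.< 0ℤ
  tail<0 = subst (ℤ._< 0ℤ) (trans (cong (ℤ._+ tail) (ℤ.i≥j⇒i⊓j≡j (ℤ.≮⇒≥ f0≮0))) (ℤ.+-identityˡ tail)) sum<0
...   | k , fk<0 = Fin.suc k , fk<0

extend : ∀ {n} → (Fin n → ℤ) → ℕ → ℤ
extend {n} v t with t ℕ.<? n
... | yes t<n = v (fromℕ< t<n)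
... | no  _   = 0ℤ

extend-fromℕ< : ∀ {n} (v : Fin n → ℤ) {t} (t<n : t ℕ.< n) → extend v t ≡ v (fromℕ< t<n)
extend-fromℕ< {n} v {t} t<n with t ℕ.<? n
... | yes t<n′ = cong v (Fin.fromℕ<-cong t t refl t<n′ t<n)
... | no  t≮n  = ⊥-elim (t≮n t<n)

extend-toℕ : ∀ {n} (v : Fin n → ℤ) k → extend v (toℕ k) ≡ v k
extend-toℕ v k = trans (extend-fromℕ< v (Fin.toℕ<n k)) (cong v (Fin.fromℕ<-toℕ k _))

-- Finite sums

∑ : ℕ → ℕ → (ℕ → ℚ) → ℚ
∑ a zero    f = 0ℚ
∑ a (suc k) f = ∑ a k f + f (a ℕ.+ k)

∑ℤ : ℕ → ℕ → (ℕ → ℤ) → ℤ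
∑ℤ a zero    f = 0ℤ
∑ℤ a (suc k) f = ∑ℤ a k f ℤ.+ f (a ℕ.+ k)

∑-unique : ∀ {a f} (G : ℕ → ℚ) → G 0 ≡ 0ℚ → (∀ k → G (suc k) ≡ G k + f (a ℕ.+ k)) →
           ∀ k → G k ≡ ∑ a k f
∑-unique G G0 Gsuc zero    = G0
∑-unique G G0 Gsuc (suc k) = trans (Gsuc k) (cong (_+ _) (∑-unique G G0 Gsuc k))

sumFrom≡∑ : ∀ a b f → sumFrom a b f ≡ ∑ a (suc b ∸ a) f
sumFrom≡∑ a b f = abstracted
  where
  -- The hole is sumFrom's local helper, which cannot be named here; Agda infers it
  -- once suc b ∸ a has been abstracted to a variable.
  helper≡∑ : ∀ k → _ ≡ ∑ a k f
  helper≡∑ = ∑-unique _ refl (λ _ → refl)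
  abstracted : sumFrom a b f ≡ ∑ a (suc b ∸ a) f
  abstracted with suc b ∸ a
  ... | k = helper≡∑ k

∑-cong : ∀ a k {f g} → (∀ j → j ℕ.< k → f (a ℕ.+ j) ≡ g (a ℕ.+ j)) → ∑ a k f ≡ ∑ a k g
∑-cong a zero    f≗g = refl
∑-cong a (suc k) f≗g = cong₂ _+_ (∑-cong a k (λ j j<k → f≗g j (ℕ.m<n⇒m<1+n j<k))) (f≗g k ℕ.≤-refl)

∑-split : ∀ a k l f → ∑ a (k ℕ.+ l) f ≡ ∑ a k f + ∑ (a ℕ.+ k) l f
∑-split a k zero    f rewrite ℕ.+-identityʳ k = sym (+-identityʳ _)
∑-split a k (suc l) f rewrite ℕ.+-suc k l | ∑-split a k l f | ℕ.+-assoc a k l =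
  +-assoc (∑ a k f) (∑ (a ℕ.+ k) l f) (f (a ℕ.+ (k ℕ.+ l)))

∑-shift : ∀ d a k f → ∑ (d ℕ.+ a) k f ≡ ∑ a k (λ i → f (d ℕ.+ i))
∑-shift d a zero    f = refl
∑-shift d a (suc k) f = cong₂ _+_ (∑-shift d a k f) (cong f (ℕ.+-assoc d a k))

∑-distrib-+ : ∀ a k f g → ∑ a k (λ i → f i + g i) ≡ ∑ a k f + ∑ a k g
∑-distrib-+ a zero    f g = refl
∑-distrib-+ a (suc k) f g rewrite ∑-distrib-+ a k f g = interchange (∑ a k f) (∑ a k g) _ _

*-distribˡ-∑ : ∀ x a k f → x * ∑ a k f ≡ ∑ a k (λ i → x * f i)
*-distribˡ-∑ x a zero    f = *-zeroʳ x
*-distribˡ-∑ x a (suc k) f rewrite sym (*-distribˡ-∑ x a k f) = *-distribˡ-+ x (∑ a k f) _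

neg-distrib-∑ : ∀ a k f → - ∑ a k f ≡ ∑ a k (λ i → - f i)
neg-distrib-∑ a zero    f = refl
neg-distrib-∑ a (suc k) f rewrite sym (neg-distrib-∑ a k f) = neg-distrib-+ (∑ a k f) _

∑-nonNeg : ∀ a k {f} → (∀ j → j ℕ.< k → 0ℚ ≤ f (a ℕ.+ j)) → 0ℚ ≤ ∑ a k f
∑-nonNeg a zero    f≥0 = ≤-refl
∑-nonNeg a (suc k) f≥0 = +-mono-≤ (∑-nonNeg a k (λ j j<k → f≥0 j (ℕ.m<n⇒m<1+n j<k))) (f≥0 k ℕ.≤-refl)

ℤtoℚ-∑ℤ : ∀ a k f → ℤtoℚ (∑ℤ a k f) ≡ ∑ a k (ℤtoℚ ∘ f)
ℤtoℚ-∑ℤ a zero    f = refl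
ℤtoℚ-∑ℤ a (suc k) f = trans (ℤtoℚ-homo-+ (∑ℤ a k f) _) (cong (_+ ℤtoℚ (f (a ℕ.+ k))) (ℤtoℚ-∑ℤ a k f))

ℕtoℚ-sumℕ : ∀ m f → ℕtoℚ (sumℕ m f) ≡ ∑ 1 m (ℕtoℚ ∘ f)
ℕtoℚ-sumℕ zero    f = refl
ℕtoℚ-sumℕ (suc m) f = trans (ℕtoℚ-homo-+ (sumℕ m f) _) (cong (_+ ℕtoℚ (f (suc m))) (ℕtoℚ-sumℕ m f))

-- Coordinates with respect to e₀, …, eₙ₋₁

E : ℕ → ℕ → ℚ
E i zero    = 1ℚ
E i (suc t) = if suc t ≡ᵇ i then 1ℚ else 0ℚ

E-nonNeg : ∀ i t → 0ℚ ≤ E i t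
E-nonNeg i zero    = ℕtoℚ-nonNeg 1
E-nonNeg i (suc t) with suc t ≡ᵇ i
... | true  = ℕtoℚ-nonNeg 1
... | false = ≤-refl

E-diag : ∀ t → E (suc t) (suc t) ≡ 1ℚ
E-diag t with suc t ≡ᵇ suc t | ℕ.≡⇒≡ᵇ (suc t) (suc t) refl
... | true | _ = refl

E-off : ∀ i t → suc t ≢ i → E i (suc t) ≡ 0ℚ
E-off i t t≢i with suc t ≡ᵇ i | ℕ.≡ᵇ⇒≡ (suc t) i
... | true  | t≡i = ⊥-elim (t≢i (t≡i _))
... | false | _   = refl

∑-E-beyond : ∀ m (x : ℕ → ℚ) t → m ℕ.≤ suc t → ∑ 0 m (λ i → x i * E i (suc t)) ≡ 0ℚ
∑-E-beyond zero    x t _     = refl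
∑-E-beyond (suc m) x t m<1+t
  rewrite ∑-E-beyond m x t (ℕ.<⇒≤ m<1+t) | E-off m t (ℕ.>⇒≢ m<1+t) = trans (+-identityˡ _) (*-zeroʳ (x m))

∑-E : ∀ m (x : ℕ → ℚ) t → suc t ℕ.< m → ∑ 0 m (λ i → x i * E i (suc t)) ≡ x (suc t)
∑-E (suc m) x t 1+t<1+m with ℕ.m≤n⇒m<n∨m≡n (ℕ.≤-pred 1+t<1+m)
... | inj₁ 1+t<m rewrite ∑-E m x t 1+t<m | E-off m t (ℕ.<⇒≢ 1+t<m) =
  trans (cong (λ y → x (suc t) + y) (*-zeroʳ (x m))) (+-identityʳ (x (suc t)))
... | inj₂ refl  rewrite ∑-E-beyond (suc t) x t ℕ.≤-refl | E-diag t =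
  trans (+-identityˡ _) (*-identityʳ (x (suc t)))

module Coordinates (r′ s′ : ℕ) (p q : ℕ → ℕ) where

  open Setup (suc r′) (suc s′) p q

  n≡1+r′+s′ : n ≡ suc (r′ ℕ.+ s′)
  n≡1+r′+s′ = ℕ.+-suc r′ s′

  -- The coordinates of eₙ in the basis e₀, …, eₙ₋₁ (eₙ-expansion); the entry p r at 0 is
  -- forced by Σ p = Σ q and q s = 1.
  D : ℕ → ℤ
  D zero    = + p (suc r′)
  D (suc t) = if suc t <ᵇ suc r′ then + p (suc t) else ℤ.- (+ q (suc t ∸ suc r′ ℕ.+ 1))

  Eₙ : ℕ → ℚ
  Eₙ zero    = 1ℚ
  Eₙ (suc t) = ℤtoℚ (D (suc t))

  e≡E : ∀ i k → e i k ≡ E i (toℕ k)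
  e≡E i k with toℕ k
  ... | zero  = refl
  ... | suc _ = refl

  eₙ≡Eₙ : ∀ k → eₙ k ≡ Eₙ (toℕ k)
  eₙ≡Eₙ k with toℕ k
  ... | zero  = refl
  ... | suc t with suc t <ᵇ suc r′
  ...   | true  = refl
  ...   | false = sym (ℤtoℚ-homo‿- (+ q (suc t ∸ suc r′ ℕ.+ 1)))

  D-p : ∀ t → suc t ℕ.< suc r′ → D (suc t) ≡ + p (suc t)
  D-p t 1+t<r with suc t <ᵇ suc r′ | ℕ.<⇒<ᵇ 1+t<r
  ... | true | _ = refl

  D-q : ∀ j → 1 ℕ.≤ j → D (r′ ℕ.+ j) ≡ ℤ.- (+ q j)
  D-q (suc j) _ rewrite ℕ.+-suc r′ j with suc (r′ ℕ.+ j) <ᵇ suc r′ | ℕ.<ᵇ⇒< (suc (r′ ℕ.+ j)) (suc r′)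
  ... | true  | r′+j<r′ = ⊥-elim (ℕ.<⇒≱ (ℕ.≤-pred (r′+j<r′ _)) (ℕ.m≤m+n r′ j))
  ... | false | _       = cong (λ m → ℤ.- (+ q m)) (trans (cong (ℕ._+ 1) (ℕ.m+n∸m≡n r′ j)) (ℕ.+-comm j 1))

  D-nonNeg : ∀ i → i ℕ.< suc r′ → 0ℤ ℤ.≤ D i
  D-nonNeg zero    _     = ℤ.+≤+ z≤n
  D-nonNeg (suc t) 1+t<r rewrite D-p t 1+t<r = ℤ.+≤+ z≤n

  neg-*-D-q : ∀ x j → 1 ℕ.≤ j → - (x * ℤtoℚ (D (r′ ℕ.+ j))) ≡ x * ℕtoℚ (q j)
  neg-*-D-q x j 1≤j rewrite D-q j 1≤j | ℤtoℚ-homo‿- (+ q j) =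
    ℚ-Solver.solve 2 (λ x y → :- (x :* :- y) := x :* y) refl x (ℕtoℚ (q j))
    where open ℚ-Solver

  Eₙ-nonNeg : ∀ t → t ℕ.< suc r′ → 0ℚ ≤ Eₙ t
  Eₙ-nonNeg zero    _     = ℕtoℚ-nonNeg 1
  Eₙ-nonNeg (suc t) 1+t<r = ℤtoℚ-mono-≤ {0ℤ} {D (suc t)} (D-nonNeg (suc t) 1+t<r)

  q-index : ∀ t → suc r′ ℕ.≤ t → t ℕ.< n → Σ ℕ λ j → 1 ℕ.≤ j × j ℕ.≤ s′ × t ≡ r′ ℕ.+ j
  q-index t r≤t t<n =
    t ∸ r′ , ℕ.m<n⇒0<n∸m r≤t ,
    ℕ.m≤n+o⇒m∸n≤o t r′ (ℕ.≤-pred (subst (t ℕ.<_) n≡1+r′+s′ t<n)) ,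
    sym (ℕ.m+[n∸m]≡n (ℕ.<⇒≤ r≤t))

  ∑-head : ∀ f → ∑ 0 n f ≡ f 0 + ∑ 1 (r′ ℕ.+ s′) f
  ∑-head f = begin
    ∑ 0 n f                              ≡⟨ cong (λ m → ∑ 0 m f) n≡1+r′+s′ ⟩
    ∑ 0 (1 ℕ.+ (r′ ℕ.+ s′)) f            ≡⟨ ∑-split 0 1 (r′ ℕ.+ s′) f ⟩
    0ℚ + f 0 + ∑ 1 (r′ ℕ.+ s′) f         ≡⟨ cong (_+ ∑ 1 (r′ ℕ.+ s′) f) (+-identityˡ (f 0)) ⟩
    f 0 + ∑ 1 (r′ ℕ.+ s′) f              ∎
    where open ≡-Reasoning

  ∑-split-pq : ∀ f → ∑ 0 n f ≡ f 0 + ∑ 1 r′ f + ∑ 1 s′ (λ j → f (r′ ℕ.+ j))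
  ∑-split-pq f = begin
    ∑ 0 n f                                                ≡⟨ ∑-head f ⟩
    f 0 + ∑ 1 (r′ ℕ.+ s′) f                                ≡⟨ cong (λ x → f 0 + x) (∑-split 1 r′ s′ f) ⟩
    f 0 + (∑ 1 r′ f + ∑ (1 ℕ.+ r′) s′ f)                   ≡⟨ cong (λ a → f 0 + (∑ 1 r′ f + ∑ a s′ f)) (ℕ.+-comm 1 r′) ⟩
    f 0 + (∑ 1 r′ f + ∑ (r′ ℕ.+ 1) s′ f)                   ≡⟨ cong (λ x → f 0 + (∑ 1 r′ f + x)) (∑-shift r′ 1 s′ f) ⟩
    f 0 + (∑ 1 r′ f + ∑ 1 s′ (λ j → f (r′ ℕ.+ j)))         ≡⟨ +-assoc (f 0) _ _ ⟨
    f 0 + ∑ 1 r′ f + ∑ 1 s′ (λ j → f (r′ ℕ.+ j))           ∎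
    where open ≡-Reasoning

  lincomb : (ℕ → ℚ) → ℕ → ℚ
  lincomb x t = ∑ 0 n (λ i → x i * E i t)

  lincomb-zero : ∀ x → lincomb x 0 ≡ ∑ 0 n x
  lincomb-zero x = ∑-cong 0 n (λ i _ → *-identityʳ (x i))

  lincomb-suc : ∀ x t → suc t ℕ.< n → lincomb x (suc t) ≡ x (suc t)
  lincomb-suc = ∑-E n

  lincomb-cong : ∀ {x y} t → (∀ i → i ℕ.< n → x i ≡ y i) → lincomb x t ≡ lincomb y t
  lincomb-cong t x≗y = ∑-cong 0 n (λ i i<n → cong (_* E i t) (x≗y i i<n))

  lincomb-+ : ∀ x y t → lincomb (λ i → x i + y i) t ≡ lincomb x t + lincomb y t
  lincomb-+ x y t = trans (∑-cong 0 n (λ i _ → *-distribʳ-+ (E i t) (x i) (y i))) (∑-distrib-+ 0 n _ _)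

  lincomb-* : ∀ a x t → lincomb (λ i → a * x i) t ≡ a * lincomb x t
  lincomb-* a x t = trans (∑-cong 0 n (λ i _ → *-assoc a (x i) (E i t))) (sym (*-distribˡ-∑ a 0 n _))

  lincomb-nonNeg : ∀ {x} t → (∀ i → i ℕ.< n → 0ℚ ≤ x i) → 0ℚ ≤ lincomb x t
  lincomb-nonNeg t x≥0 = ∑-nonNeg 0 n (λ i i<n → *-nonNeg (x≥0 i i<n) (E-nonNeg i t))

  sumFrom-gen : ∀ (c : ℕ → ℚ) k → sumFrom 0 n (λ i → c i * gen i k) ≡ lincomb c (toℕ k) + c n * Eₙ (toℕ k)
  sumFrom-gen c k = trans (sumFrom≡∑ 0 n _)
    (cong₂ _+_ (∑-cong 0 n (λ i i<n → cong (c i *_) (gen-below i i<n))) (cong (c n *_) gen-top))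
    where
    gen-below : ∀ i → i ℕ.< n → gen i k ≡ E i (toℕ k)
    gen-below i i<n with i ≡ᵇ n | ℕ.≡ᵇ⇒≡ i n
    ... | true  | i≡n = ⊥-elim (ℕ.<⇒≢ i<n (i≡n _))
    ... | false | _   = e≡E i k
    gen-top : gen n k ≡ Eₙ (toℕ k)
    gen-top with n ≡ᵇ n | ℕ.≡⇒≡ᵇ n n refl
    ... | true | _ = eₙ≡Eₙ k

  sumFrom-e : ∀ (x : ℕ → ℚ) k → sumFrom 0 (n ∸ 1) (λ i → x i * e i k) ≡ lincomb x (toℕ k)
  sumFrom-e x k = begin
    sumFrom 0 (n ∸ 1) (λ i → x i * e i k)  ≡⟨ sumFrom≡∑ 0 (n ∸ 1) _ ⟩
    ∑ 0 (suc (n ∸ 1)) (λ i → x i * e i k)  ≡⟨ cong (λ m → ∑ 0 m (λ i → x i * e i k)) 1+[n-1]≡n ⟩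
    ∑ 0 n (λ i → x i * e i k)              ≡⟨ ∑-cong 0 n (λ i _ → cong (x i *_) (e≡E i k)) ⟩
    lincomb x (toℕ k)                      ∎
    where
    open ≡-Reasoning
    1+[n-1]≡n : suc (n ∸ 1) ≡ n
    1+[n-1]≡n = trans (cong (λ m → suc (m ∸ 1)) n≡1+r′+s′) (sym n≡1+r′+s′)

  basisCoeff : (Fin n → ℤ) → ℕ → ℤ
  basisCoeff v zero    = extend v 0 ℤ.- ∑ℤ 1 (r′ ℕ.+ s′) (extend v)
  basisCoeff v (suc t) = extend v (suc t)

  basisCoeff-correct : ∀ (v : Fin n → ℤ) (y : ℕ → ℚ) → (∀ k → ℤtoℚ (v k) ≡ lincomb y (toℕ k)) →
                       ∀ i → i ℕ.< n → ℤtoℚ (basisCoeff v i) ≡ y i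
  basisCoeff-correct v y v≡y = correct
    where
    coordinate : ∀ t → t ℕ.< n → ℤtoℚ (extend v t) ≡ lincomb y t
    coordinate t t<n = begin
      ℤtoℚ (extend v t)              ≡⟨ cong ℤtoℚ (extend-fromℕ< v t<n) ⟩
      ℤtoℚ (v (fromℕ< t<n))          ≡⟨ v≡y (fromℕ< t<n) ⟩
      lincomb y (toℕ (fromℕ< t<n))   ≡⟨ cong (lincomb y) (Fin.toℕ-fromℕ< t<n) ⟩
      lincomb y t                    ∎
      where open ≡-Reasoning
    correct-suc : ∀ t → suc t ℕ.< n → ℤtoℚ (extend v (suc t)) ≡ y (suc t)
    correct-suc t 1+t<n = trans (coordinate (suc t) 1+t<n) (lincomb-suc y t 1+t<n)
    correct : ∀ i → i ℕ.< n → ℤtoℚ (basisCoeff v i) ≡ y i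
    correct (suc t) 1+t<n = correct-suc t 1+t<n
    correct zero    0<n = begin
      ℤtoℚ (extend v 0 ℤ.- ∑ℤ 1 N (extend v))
        ≡⟨ trans (ℤtoℚ-homo-+ (extend v 0) _) (cong (λ x → ℤtoℚ (extend v 0) + x) (ℤtoℚ-homo‿- (∑ℤ 1 N (extend v)))) ⟩
      ℤtoℚ (extend v 0) - ℤtoℚ (∑ℤ 1 N (extend v))
        ≡⟨ cong₂ _-_ (trans (coordinate 0 0<n) (trans (lincomb-zero y) (∑-head y))) (ℤtoℚ-∑ℤ 1 N _) ⟩
      y 0 + ∑ 1 N y - ∑ 1 N (ℤtoℚ ∘ extend v)
        ≡⟨ cong (λ x → y 0 + ∑ 1 N y - x) (∑-cong 1 N (λ j j<N → correct-suc j (1+j<n j<N))) ⟩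
      y 0 + ∑ 1 N y - ∑ 1 N y
        ≡⟨ ℚ-Solver.solve 2 (λ a b → a :+ b :- b := a) refl (y 0) (∑ 1 N y) ⟩
      y 0 ∎
      where
      open ≡-Reasoning
      open ℚ-Solver
      N : ℕ
      N = r′ ℕ.+ s′
      1+j<n : ∀ {j} → j ℕ.< N → suc j ℕ.< n
      1+j<n j<N = subst (ℕ._<_ _) (sym n≡1+r′+s′) (s≤s j<N)

  basisCoeff-pos : ∀ v i → 1 ℕ.≤ i → basisCoeff v i ≡ extend v i
  basisCoeff-pos v (suc _) _ = refl

  cone-nonNeg : ∀ (c : ℕ → ℚ) (v : Fin n → ℤ) → (∀ i → i ℕ.≤ n → 0ℚ ≤ c i) →
                (∀ k → sumFrom 0 n (λ i → c i * gen i k) ≡ ℤtoℚ (v k)) →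
                ∀ k → toℕ k ℕ.< suc r′ → 0ℤ ℤ.≤ v k
  cone-nonNeg c v c≥0 Σc≡v k k<r = ℤtoℚ-cancel-≤ {0ℤ} {v k} (subst (0ℚ ≤_) (trans (sym (sumFrom-gen c k)) (Σc≡v k))
    (+-mono-≤ (lincomb-nonNeg (toℕ k) (λ i i<n → c≥0 i (ℕ.<⇒≤ i<n))) (*-nonNeg (c≥0 n ℕ.≤-refl) (Eₙ-nonNeg (toℕ k) k<r))))

  ∃-negative-q-coeff : ∀ (c : ℕ → ℚ) (v : Fin n → ℤ) → (∀ i → i ℕ.≤ n → 0ℚ ≤ c i) →
                     (∀ k → sumFrom 0 n (λ i → c i * gen i k) ≡ ℤtoℚ (v k)) → depth v ℤ.< 0ℤ →
                     Σ ℕ λ j → 1 ℕ.≤ j × j ℕ.≤ s′ × basisCoeff v (r′ ℕ.+ j) ℤ.< 0ℤ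
  ∃-negative-q-coeff c v c≥0 Σc≡v depth<0 with ∃-negative-entry n v depth<0
  ... | k , vk<0 with toℕ k ℕ.<? suc r′
  ...   | yes k<r = ⊥-elim (ℤ.<⇒≱ vk<0 (cone-nonNeg c v c≥0 Σc≡v k k<r))
  ...   | no  k≮r with q-index (toℕ k) (ℕ.≮⇒≥ k≮r) (Fin.toℕ<n k)
  ...     | j , 1≤j , j≤s′ , k≡r′+j = j , 1≤j , j≤s′ , subst (ℤ._< 0ℤ) vk≡coeff vk<0
    where
    vk≡coeff : v k ≡ basisCoeff v (r′ ℕ.+ j)
    vk≡coeff = begin
      v k                       ≡⟨ extend-toℕ v k ⟨
      extend v (toℕ k)          ≡⟨ cong (extend v) k≡r′+j ⟩
      extend v (r′ ℕ.+ j)       ≡⟨ basisCoeff-pos v (r′ ℕ.+ j) (ℕ.≤-trans 1≤j (ℕ.m≤n+m j r′)) ⟨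
      basisCoeff v (r′ ℕ.+ j)   ∎
      where open ≡-Reasoning

  u-in-basis : ∀ b k → u b k ≡ b * Eₙ (toℕ k) + lincomb (λ i → frac (- (b * ℤtoℚ (D i)))) (toℕ k)
  u-in-basis b k = begin
    u b k
      ≡⟨ cong₂ _+_ (cong₂ _+_ (cong₂ _+_ (cong (b *_) (eₙ≡Eₙ k)) (cong (f 0 *_) (e≡E 0 k))) p-part) q-part ⟩
    b * Eₙ t + f 0 * E 0 t + Σp + Σq
      ≡⟨ trans (+-assoc (b * Eₙ t + f 0 * E 0 t) Σp Σq) (+-assoc (b * Eₙ t) (f 0 * E 0 t) (Σp + Σq)) ⟩
    b * Eₙ t + (f 0 * E 0 t + (Σp + Σq))
      ≡⟨ cong (λ x → b * Eₙ t + x) (trans (sym (+-assoc (f 0 * E 0 t) Σp Σq)) (sym (∑-split-pq (λ i → f i * E i t)))) ⟩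
    b * Eₙ t + lincomb f t ∎
    where
    open ≡-Reasoning
    t : ℕ
    t = toℕ k
    f : ℕ → ℚ
    f i = frac (- (b * ℤtoℚ (D i)))
    Σp Σq : ℚ
    Σp = ∑ 1 r′ (λ i → f i * E i t)
    Σq = ∑ 1 s′ (λ j → f (r′ ℕ.+ j) * E (r′ ℕ.+ j) t)
    p-part : sumFrom 1 r′ (λ i → frac (- (b * ℕtoℚ (p i))) * e i k) ≡ Σp
    p-part = trans (sumFrom≡∑ 1 r′ _) (∑-cong 1 r′ (λ j j<r′ →
      cong₂ _*_ (cong (λ d → frac (- (b * ℤtoℚ d))) (sym (D-p j (s≤s j<r′)))) (e≡E (suc j) k)))
    q-part : sumFrom 1 s′ (λ j → frac (b * ℕtoℚ (q j)) * e (r′ ℕ.+ j) k) ≡ Σq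
    q-part = trans (sumFrom≡∑ 1 s′ _) (∑-cong 1 s′ (λ j _ →
      cong₂ _*_ (cong frac (sym (neg-*-D-q b (suc j) (s≤s z≤n)))) (e≡E (r′ ℕ.+ suc j) k)))

  module Balanced (qₛ≡1 : q (suc s′) ≡ 1) (Σp≡Σq : sumℕ (suc r′) p ≡ sumℕ (suc s′) q) where

    ∑D≡1 : ∑ 0 n (ℤtoℚ ∘ D) ≡ 1ℚ
    ∑D≡1 = begin
      ∑ 0 n (ℤtoℚ ∘ D)
        ≡⟨ ∑-split-pq (ℤtoℚ ∘ D) ⟩
      pᵣ + ∑ 1 r′ (ℤtoℚ ∘ D) + ∑ 1 s′ (λ j → ℤtoℚ (D (r′ ℕ.+ j)))
        ≡⟨ cong₂ (λ x y → pᵣ + x + y)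
             (∑-cong 1 r′ (λ j j<r′ → cong ℤtoℚ (D-p j (s≤s j<r′))))
             (∑-cong 1 s′ (λ j _ → trans (cong ℤtoℚ (D-q (suc j) (s≤s z≤n))) (ℤtoℚ-homo‿- (+ q (suc j))))) ⟩
      pᵣ + ∑ 1 r′ (ℕtoℚ ∘ p) + ∑ 1 s′ (λ j → - ℕtoℚ (q j))
        ≡⟨ cong₂ (λ x y → pᵣ + x + y) (sym (ℕtoℚ-sumℕ r′ p)) (trans (sym (neg-distrib-∑ 1 s′ _)) (cong -_ (sym (ℕtoℚ-sumℕ s′ q)))) ⟩
      pᵣ + Σp - Σq
        ≡⟨ ℚ-Solver.solve 3 (λ pᵣ Σp Σq → pᵣ :+ Σp :- Σq := (Σp :+ pᵣ) :- Σq) refl pᵣ Σp Σq ⟩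
      (Σp + pᵣ) - Σq
        ≡⟨ cong (_- Σq) Σp+pᵣ≡Σq+1 ⟩
      (Σq + 1ℚ) - Σq
        ≡⟨ ℚ-Solver.solve 1 (λ Σq → (Σq :+ con 1ℚ) :- Σq := con 1ℚ) refl Σq ⟩
      1ℚ ∎
      where
      open ≡-Reasoning
      open ℚ-Solver using (_:+_; _:-_; _:=_; con)
      pᵣ Σp Σq : ℚ
      pᵣ = ℕtoℚ (p (suc r′))
      Σp = ℕtoℚ (sumℕ r′ p)
      Σq = ℕtoℚ (sumℕ s′ q)
      Σp+pᵣ≡Σq+1 : Σp + pᵣ ≡ Σq + 1ℚ
      Σp+pᵣ≡Σq+1 = begin
        Σp + pᵣ                               ≡⟨ ℕtoℚ-homo-+ (sumℕ r′ p) (p (suc r′)) ⟨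
        ℕtoℚ (sumℕ (suc r′) p)                ≡⟨ cong ℕtoℚ Σp≡Σq ⟩
        ℕtoℚ (sumℕ s′ q ℕ.+ q (suc s′))       ≡⟨ ℕtoℚ-homo-+ (sumℕ s′ q) (q (suc s′)) ⟩
        Σq + ℕtoℚ (q (suc s′))                ≡⟨ cong (λ m → Σq + ℕtoℚ m) qₛ≡1 ⟩
        Σq + 1ℚ                               ∎

    eₙ-expansion : ∀ t → t ℕ.< n → Eₙ t ≡ lincomb (ℤtoℚ ∘ D) t
    eₙ-expansion zero    _     = sym (trans (lincomb-zero (ℤtoℚ ∘ D)) ∑D≡1)
    eₙ-expansion (suc t) 1+t<n = sym (lincomb-suc (ℤtoℚ ∘ D) t 1+t<n)

    cone-in-basis : ∀ (c : ℕ → ℚ) (v : Fin n → ℤ) → (∀ k → sumFrom 0 n (λ i → c i * gen i k) ≡ ℤtoℚ (v k)) →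
                    ∀ k → ℤtoℚ (v k) ≡ lincomb (λ i → c i + c n * ℤtoℚ (D i)) (toℕ k)
    cone-in-basis c v Σc≡v k = begin
      ℤtoℚ (v k)                                        ≡⟨ Σc≡v k ⟨
      sumFrom 0 n (λ i → c i * gen i k)                 ≡⟨ sumFrom-gen c k ⟩
      lincomb c t + c n * Eₙ t                          ≡⟨ cong (λ x → lincomb c t + c n * x) (eₙ-expansion t (Fin.toℕ<n k)) ⟩
      lincomb c t + c n * lincomb (ℤtoℚ ∘ D) t          ≡⟨ cong (λ x → lincomb c t + x) (lincomb-* (c n) (ℤtoℚ ∘ D) t) ⟨
      lincomb c t + lincomb (λ i → c n * ℤtoℚ (D i)) t  ≡⟨ lincomb-+ c _ t ⟨
      lincomb (λ i → c i + c n * ℤtoℚ (D i)) t          ∎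
      where
      open ≡-Reasoning
      t : ℕ
      t = toℕ k

    shift-nonNeg : ∀ (c : ℕ → ℚ) (v : Fin n → ℤ) → (∀ i → i ℕ.≤ n → 0ℚ ≤ c i) →
                   (∀ k → sumFrom 0 n (λ i → c i * gen i k) ≡ ℤtoℚ (v k)) →
                   (∀ j → 1 ℕ.≤ j → j ℕ.≤ s′ → 1 ℕ.≤ q j) →
                   (S : MinimalShift (λ j → basisCoeff v (r′ ℕ.+ j)) q s′) →
                   ∀ i → i ℕ.< n → 0ℚ ≤ c i + c n * ℤtoℚ (D i) - MinimalShift.μ S * ℤtoℚ (D i)
    shift-nonNeg c v c≥0 Σc≡v q≥1 S = x≥0
      where
      open MinimalShift S
      coeff≡y : ∀ i → i ℕ.< n → ℤtoℚ (basisCoeff v i) ≡ c i + c n * ℤtoℚ (D i)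
      coeff≡y = basisCoeff-correct v (λ i → c i + c n * ℤtoℚ (D i)) (cone-in-basis c v Σc≡v)
      r′+j<n : ∀ {j} → j ℕ.≤ s′ → r′ ℕ.+ j ℕ.< n
      r′+j<n j≤s′ = subst (ℕ._<_ _) (sym n≡1+r′+s′) (s≤s (ℕ.+-monoʳ-≤ r′ j≤s′))
      μ≤cₙ : μ ≤ c n
      μ≤cₙ = *-cancelʳ-≤-pos (ℕtoℚ (q J)) {{ℕtoℚ-pos (q≥1 J 1≤J J≤m)}} (begin
        μ * ℕtoℚ (q J)                               ≡⟨ trans tight (ℤtoℚ-homo‿- (basisCoeff v (r′ ℕ.+ J))) ⟩
        - ℤtoℚ (basisCoeff v (r′ ℕ.+ J))             ≡⟨ cong -_ (coeff≡y (r′ ℕ.+ J) (r′+j<n J≤m)) ⟩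
        - (c (r′ ℕ.+ J) + c n * ℤtoℚ (D (r′ ℕ.+ J))) ≡⟨ neg-distrib-+ (c (r′ ℕ.+ J)) _ ⟩
        - c (r′ ℕ.+ J) - c n * ℤtoℚ (D (r′ ℕ.+ J))   ≡⟨ cong (λ x → - c (r′ ℕ.+ J) + x) (neg-*-D-q (c n) J 1≤J) ⟩
        - c (r′ ℕ.+ J) + c n * ℕtoℚ (q J)            ≤⟨ +-monoˡ-≤ (c n * ℕtoℚ (q J)) (neg-antimono-≤ (c≥0 (r′ ℕ.+ J) (ℕ.<⇒≤ (r′+j<n J≤m)))) ⟩
        0ℚ + c n * ℕtoℚ (q J)                        ≡⟨ +-identityˡ (c n * ℕtoℚ (q J)) ⟩
        c n * ℕtoℚ (q J)                             ∎)
        where open ≤-Reasoning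
      x≥0 : ∀ i → i ℕ.< n → 0ℚ ≤ c i + c n * ℤtoℚ (D i) - μ * ℤtoℚ (D i)
      x≥0 i i<n with i ℕ.<? suc r′
      ... | yes i<r = subst (0ℚ ≤_)
              (ℚ-Solver.solve 4 (λ x y m d → x :+ (y :- m) :* d := x :+ y :* d :- m :* d) refl (c i) (c n) μ (ℤtoℚ (D i)))
              (+-mono-≤ (c≥0 i (ℕ.<⇒≤ i<n)) (*-nonNeg (p≤q⇒0≤q-p μ≤cₙ) (ℤtoℚ-mono-≤ {0ℤ} {D i} (D-nonNeg i i<r))))
        where open ℚ-Solver
      ... | no  i≮r with q-index i (ℕ.≮⇒≥ i≮r) i<n
      ...   | j , 1≤j , j≤s′ , refl = subst (0ℚ ≤_)
              (cong₂ _+_ (coeff≡y (r′ ℕ.+ j) i<n) (sym (neg-*-D-q μ j 1≤j)))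
              (feasible j 1≤j j≤s′)

    shift⇒translate : ∀ (v : Fin n → ℤ) (y : ℕ → ℚ) → (∀ k → ℤtoℚ (v k) ≡ lincomb y (toℕ k)) →
                      ∀ b J → (∀ i → i ℕ.< n → 0ℚ ≤ y i - (b + ℕtoℚ J) * ℤtoℚ (D i)) → InTranslate b v
    shift⇒translate v y v≡y b J x≥0 = a , J , coordinate
      where
      μ : ℚ
      μ = b + ℕtoℚ J
      f : ℕ → ℚ
      f i = frac (- (b * ℤtoℚ (D i)))
      A : ℕ → ℤ
      A i = basisCoeff v i ℤ.- + J ℤ.* D i ℤ.+ floor (- (b * ℤtoℚ (D i)))
      A+f≡x : ∀ i → i ℕ.< n → ℤtoℚ (A i) + f i ≡ y i - μ * ℤtoℚ (D i)
      A+f≡x i i<n = trans (floor-decomposition (basisCoeff v i) (D i) b J)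
                          (cong (_- μ * ℤtoℚ (D i)) (basisCoeff-correct v y v≡y i i<n))
      a : ℕ → ℕ
      a i = ℤ.∣ A i ∣
      y≡a+f+μD : ∀ i → i ℕ.< n → y i ≡ ℕtoℚ (a i) + f i + μ * ℤtoℚ (D i)
      y≡a+f+μD i i<n = begin
        y i                                 ≡⟨ ℚ-Solver.solve 2 (λ y m → y := y :- m :+ m) refl (y i) (μ * ℤtoℚ (D i)) ⟩
        y i - μ * ℤtoℚ (D i) + μ * ℤtoℚ (D i) ≡⟨ cong (_+ μ * ℤtoℚ (D i)) (A+f≡x i i<n) ⟨
        ℤtoℚ (A i) + f i + μ * ℤtoℚ (D i)   ≡⟨ cong (λ z → ℤtoℚ z + f i + μ * ℤtoℚ (D i)) (ℤ.0≤i⇒+∣i∣≡i A≥0) ⟨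
        ℕtoℚ (a i) + f i + μ * ℤtoℚ (D i)   ∎
        where
        open ≡-Reasoning
        open ℚ-Solver using (_:+_; _:-_; _:=_)
        A≥0 : 0ℤ ℤ.≤ A i
        A≥0 = nonNeg-integer (subst (0ℚ ≤_) (sym (A+f≡x i i<n)) (x≥0 i i<n)) (frac<1 (- (b * ℤtoℚ (D i))))
      coordinate : ∀ k → ℤtoℚ (v k) ≡ u b k + sumFrom 0 (n ∸ 1) (λ i → ℕtoℚ (a i) * e i k) + ℕtoℚ J * eₙ k
      coordinate k = begin
        ℤtoℚ (v k)
          ≡⟨ v≡y k ⟩
        lincomb y t
          ≡⟨ lincomb-cong t y≡a+f+μD ⟩
        lincomb (λ i → ℕtoℚ (a i) + f i + μ * ℤtoℚ (D i)) t
          ≡⟨ trans (lincomb-+ (λ i → ℕtoℚ (a i) + f i) (λ i → μ * ℤtoℚ (D i)) t) (cong₂ _+_ (lincomb-+ (ℕtoℚ ∘ a) f t) (lincomb-* μ (ℤtoℚ ∘ D) t)) ⟩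
        lincomb (ℕtoℚ ∘ a) t + lincomb f t + μ * lincomb (ℤtoℚ ∘ D) t
          ≡⟨ cong (λ x → lincomb (ℕtoℚ ∘ a) t + lincomb f t + μ * x) (eₙ-expansion t (Fin.toℕ<n k)) ⟨
        lincomb (ℕtoℚ ∘ a) t + lincomb f t + (b + ℕtoℚ J) * Eₙ t
          ≡⟨ ℚ-Solver.solve 5 (λ A F b j E → A :+ F :+ (b :+ j) :* E := b :* E :+ F :+ A :+ j :* E) refl
               (lincomb (ℕtoℚ ∘ a) t) (lincomb f t) b (ℕtoℚ J) (Eₙ t) ⟩
        b * Eₙ t + lincomb f t + lincomb (ℕtoℚ ∘ a) t + ℕtoℚ J * Eₙ t
          ≡⟨ cong₂ _+_ (cong₂ _+_ (u-in-basis b k) (sumFrom-e (ℕtoℚ ∘ a) k)) (cong (ℕtoℚ J *_) (eₙ≡Eₙ k)) ⟨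
        u b k + sumFrom 0 (n ∸ 1) (λ i → ℕtoℚ (a i) * e i k) + ℕtoℚ J * eₙ k
          ∎
        where
        open ≡-Reasoning
        open ℚ-Solver using (_:+_; _:*_; _:=_)
        t : ℕ
        t = toℕ k

lemma4p2 : (r s : ℕ) (p q : ℕ → ℕ) →
    1 ℕ.≤ r → 1 ℕ.≤ s →
    (∀ i → 1 ℕ.≤ i → i ℕ.≤ r → 1 ℕ.≤ p i) →
    (∀ j → 1 ℕ.≤ j → j ℕ.≤ s → 1 ℕ.≤ q j) →
    (∀ i j → 1 ℕ.≤ i → i ℕ.≤ r → 1 ℕ.≤ j → j ℕ.≤ s → p i ≢ q j) →
    q s ≡ 1 →
    sumℕ r p ≡ sumℕ s q →
    (v : Fin (Setup.n r s p q) → ℤ) →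
    Setup.Primitive r s p q v →
    Σ ℚ λ b → Setup.Inβ r s p q b × Setup.InTranslate r s p q b v
lemma4p2 zero     _        _ _ ()
lemma4p2 (suc _)  zero     _ _ _ ()
lemma4p2 (suc r′) (suc s′) p q _ _ _ q≥1 _ qₛ≡1 Σp≡Σq v ((c , c≥0 , Σc≡v) , depth<0) =
  let open Setup (suc r′) (suc s′) p q
      open Coordinates r′ s′ p q
      open Balanced qₛ≡1 Σp≡Σq
      q≥1′ : ∀ j → 1 ℕ.≤ j → j ℕ.≤ s′ → 1 ℕ.≤ q j
      q≥1′ j 1≤j j≤s′ = q≥1 j 1≤j (ℕ.m≤n⇒m≤1+n j≤s′)
      y : ℕ → ℚ
      y t = c t + c n * ℤtoℚ (D t)
      (j₀ , 1≤j₀ , j₀≤s′ , zj₀<0) = ∃-negative-q-coeff c v c≥0 Σc≡v depth<0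
      S : MinimalShift (λ j → basisCoeff v (r′ ℕ.+ j)) q s′
      S = minimal-shift _ q s′ q≥1′ j₀ 1≤j₀ j₀≤s′ zj₀<0
      open MinimalShift S
      (i , J′ , 1≤i , i≤qJ , μ≡b+J′) = fraction-split (q≥1′ J 1≤J J≤m) μ zJ<0 tight
      b : ℚ
      b = divℚ i (q J)
      x≥0 : ∀ t → t ℕ.< n → 0ℚ ≤ y t - (b + ℕtoℚ J′) * ℤtoℚ (D t)
      x≥0 = subst (λ μ → ∀ t → t ℕ.< n → 0ℚ ≤ y t - μ * ℤtoℚ (D t)) μ≡b+J′ (shift-nonNeg c v c≥0 Σc≡v q≥1′ S)
  in b , (J , 1≤J , ℕ.m≤n⇒m≤1+n J≤m , i , 1≤i , i≤qJ , refl) , shift⇒translate v y (cone-in-basis c v Σc≡v) b J′ x≥0
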